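{- There is no Turing machine that, upon input of the code of an arbitrary computable binary-valued function class $\mathcal{G}\subseteq\{0,1\}^{\mathbb{N}}$, decides whether $\operatorname{Tdim}(\mathcal{G})<\infty$. That is, finiteness of the teaching dimension is Turing undecidable.
   Context: $\mathbb{N}=\{0,1,2,\dots\}$. A class $\mathcal{G}\subseteq\mathbb{N}^{\mathbb{N}}$ is computable if there is a total computable $G:\mathbb{N}\times\mathbb{N}\to\mathbb{N}$ with $\mathcal{G}=\{n\mapsto G(m,n): m\in\mathbb{N}\}$; the code of the class is the code of $G$ with respect to a fixed universal Turing machine. For $g\in\mathcal{G}$, a set $S\subseteq\mathbb{N}\times\{0,1\}$ (possibly infinite) is a teaching set for $g$ in $\mathcal{G}$ if $g(x)=y$ for all $(x,y)\in S$ and every $\tilde g\in\mathcal{G}\setminus\{g\}$ has $\tilde g(x)\ne y$ for some $(x,y)\in S$. The teaching dimension is $\operatorname{Tdim}(\mathcal{G})=\sup_{g\in\mathcal{G}}\inf\{|S|: S \text{ a teaching set for } g\}$. -}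

module Defs where

open import Data.Nat using (ℕ; zero; suc; _≤_; _<_; _%_; _/_)
open import Data.Fin using (Fin; toℕ)
open import Data.List using (List; []; _∷_; length)
open import Data.List.Relation.Unary.All using (All)
open import Data.List.Relation.Unary.Any using (Any)
open import Data.Product using (Σ; ∃; ∃-syntax; _×_; _,_; proj₁)
open import Data.Sum using (_⊎_)
open import Relation.Nullary using (¬_)
open import Relation.Binary.PropositionalEquality using (_≡_; _≢_)

-- Model of computation: (untyped-arity) μ-recursive programs.
-- Arguments are a list of naturals; missing arguments default to 0.

data Prog : Set where
  Z    : Prog
  S    : Prog
  P    : ℕ → Prog
  C    : Prog → List Prog → Prog
  R    : Prog → Prog → Prog        -- primitive recursion on first argument
  M    : Prog → Prog               -- unbounded minimisation μy. f(y ∷ xs) = 0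

hd : List ℕ → ℕ
hd []      = 0
hd (x ∷ _) = x

tl : List ℕ → List ℕ
tl []       = []
tl (_ ∷ xs) = xs

nth : List ℕ → ℕ → ℕ
nth []       _       = 0
nth (x ∷ _)  zero    = x
nth (_ ∷ xs) (suc i) = nth xs i

mutual
  data _⊢_⇓_ : Prog → List ℕ → ℕ → Set where
    ev-Z : ∀ {xs} → Z ⊢ xs ⇓ 0
    ev-S : ∀ {xs} → S ⊢ xs ⇓ suc (hd xs)
    ev-P : ∀ {i xs} → P i ⊢ xs ⇓ nth xs i
    ev-C : ∀ {f gs xs ys v} → gs ⊢* xs ⇓ ys → f ⊢ ys ⇓ v → C f gs ⊢ xs ⇓ v
    ev-R0 : ∀ {f g xs v} → f ⊢ xs ⇓ v → R f g ⊢ 0 ∷ xs ⇓ v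
    ev-RS : ∀ {f g n xs r v} → R f g ⊢ n ∷ xs ⇓ r → g ⊢ n ∷ r ∷ xs ⇓ v
          → R f g ⊢ suc n ∷ xs ⇓ v
    ev-R[] : ∀ {f g v} → R f g ⊢ 0 ∷ [] ⇓ v → R f g ⊢ [] ⇓ v
    ev-M : ∀ {f xs y} → f ⊢ y ∷ xs ⇓ 0
         → (∀ z → z < y → ∃[ w ] (f ⊢ z ∷ xs ⇓ suc w))
         → M f ⊢ xs ⇓ y

  data _⊢*_⇓_ : List Prog → List ℕ → List ℕ → Set where
    ev-[] : ∀ {xs} → [] ⊢* xs ⇓ []
    ev-∷  : ∀ {g gs xs y ys} → g ⊢ xs ⇓ y → gs ⊢* xs ⇓ ys → (g ∷ gs) ⊢* xs ⇓ (y ∷ ys)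

-- Cantor enumeration of ℕ × ℕ : (0,0),(0,1),(1,0),(0,2),(1,1),(2,0),…
unpair : ℕ → ℕ × ℕ
unpair zero = (0 , 0)
unpair (suc n) with unpair n
... | (a , zero)  = (0 , suc a)
... | (a , suc b) = (suc a , b)

mutual
  decodeF : ℕ → ℕ → Prog
  decodeF zero    _ = Z
  decodeF (suc f) n = byTag f (n % 6) (n / 6)

  byTag : ℕ → ℕ → ℕ → Prog
  byTag f 0 r = Z
  byTag f 1 r = S
  byTag f 2 r = P r
  byTag f 3 r with unpair r
  ... | (a , b) = C (decodeF f a) (decodeListF f b)
  byTag f 4 r with unpair r
  ... | (a , b) = R (decodeF f a) (decodeF f b)
  byTag f _ r = M (decodeF f r)

  decodeListF : ℕ → ℕ → List Prog
  decodeListF zero    _       = []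
  decodeListF (suc f) zero    = []
  decodeListF (suc f) (suc n) with unpair n
  ... | (h , t) = decodeF f h ∷ decodeListF f t

decode : ℕ → Prog
decode c = decodeF (suc c) c

record BinaryClassCode (c : ℕ) : Set where
  field
    total  : ∀ m n → ∃[ v ] (decode c ⊢ m ∷ n ∷ [] ⇓ v)
    binary : ∀ m n v → decode c ⊢ m ∷ n ∷ [] ⇓ v → v ≤ 1

classFun : ∀ {c} → BinaryClassCode c → ℕ → ℕ → ℕ
classFun bc m n = proj₁ (BinaryClassCode.total bc m n)

-- Teaching sets and finiteness of the teaching dimension.
-- The class is 𝒢 = { g_m = (n ↦ G m n) : m ∈ ℕ }.

IsTeachingSet : (ℕ → ℕ → ℕ) → ℕ → List (ℕ × Fin 2) → Set
IsTeachingSet G m Ex =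
  All (λ { (x , y) → G m x ≡ toℕ y }) Ex
  × (∀ m′ → ¬ (∀ n → G m′ n ≡ G m n)
          → Any (λ { (x , y) → G m′ x ≢ toℕ y }) Ex)

TdimFinite : (ℕ → ℕ → ℕ) → Set
TdimFinite G = ∃[ k ] (∀ m → ∃[ Ex ] (length Ex ≤ k × IsTeachingSet G m Ex))

DecidesFiniteTdim : Prog → Set
DecidesFiniteTdim d =
  ∀ c → (bc : BinaryClassCode c) →
    (d ⊢ c ∷ [] ⇓ 1 × TdimFinite (classFun bc))
    ⊎ (d ⊢ c ∷ [] ⇓ 0 × ¬ TdimFinite (classFun bc))

-- If a program d decided finiteness of the teaching dimension, Kleene's recursion theorem
-- would give a code c of the class whose row m is the indicator of {m ∸ 1} once d, run on c
-- with fuel m, has returned 1, and identically zero otherwise. If d answers 1 on c, the zero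
-- row agrees on any finite sample with the indicator of a singleton lying beyond the sample,
-- so it has no finite teaching set; if d answers 0, all rows are zero and the empty sample
-- teaches every function. Either way d errs on c. The recursion theorem needs a fuelled
-- interpreter of μ-recursive programs that is itself a μ-recursive program, and a
-- computable inverse of the decoding of programs.

module Submission where

open import Defs
open import Data.Product using (∃-syntax)
open import Relation.Nullary using (¬_)

open import Data.Nat using (ℕ; zero; suc; _≤_; _<_; _+_; _*_; _∸_; pred; z≤n; s≤s; s≤s⁻¹; _⊔_; _<?_)
open import Data.Nat.Properties
open import Data.Nat.DivMod using (_%_; _/_; [m+kn]%n≡m%n; m<n⇒m%n≡m; +-distrib-/; m*n%n≡0; m<n⇒m/n≡0; m*n/n≡m)
open import Data.List using (List; []; _∷_; length; map; _++_)
open import Data.List.Properties using (length-++; ++-assoc; map-∘; map-id; ∷-injective)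
import Data.List.Relation.Unary.All as All
open All using (All; []; _∷_)
open import Data.Fin using (Fin)
open import Data.Product using (_×_; _,_; proj₁; proj₂)
open import Data.Sum using (inj₁; inj₂)
open import Data.Empty using (⊥-elim)
open import Data.Unit using (tt)
open import Relation.Nullary.Decidable using (toWitness)
open import Relation.Binary.Definitions using (tri<; tri≈; tri>)
open import Relation.Binary.PropositionalEquality

mutual
  ⇓-deterministic : ∀ {p xs v w} → p ⊢ xs ⇓ v → p ⊢ xs ⇓ w → v ≡ w
  ⇓-deterministic ev-Z ev-Z = refl
  ⇓-deterministic ev-S ev-S = refl
  ⇓-deterministic ev-P ev-P = refl
  ⇓-deterministic (ev-C gs⇓ f⇓) (ev-C gs⇓′ f⇓′) with ⇓*-deterministic gs⇓ gs⇓′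
  ... | refl = ⇓-deterministic f⇓ f⇓′
  ⇓-deterministic (ev-R0 f⇓) (ev-R0 f⇓′) = ⇓-deterministic f⇓ f⇓′
  ⇓-deterministic (ev-RS r⇓ g⇓) (ev-RS r⇓′ g⇓′) with ⇓-deterministic r⇓ r⇓′
  ... | refl = ⇓-deterministic g⇓ g⇓′
  ⇓-deterministic (ev-R[] r⇓) (ev-R[] r⇓′) = ⇓-deterministic r⇓ r⇓′
  ⇓-deterministic (ev-M {y = y} hit below) (ev-M {y = y′} hit′ below′) with <-cmp y y′
  ... | tri< y<y′ _ _ = ⊥-elim (0≢1+n (⇓-deterministic hit (proj₂ (below′ y y<y′))))
  ... | tri≈ _ y≡y′ _ = y≡y′
  ... | tri> _ _ y′<y = ⊥-elim (0≢1+n (⇓-deterministic hit′ (proj₂ (below y′ y′<y))))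

  ⇓*-deterministic : ∀ {gs xs vs ws} → gs ⊢* xs ⇓ vs → gs ⊢* xs ⇓ ws → vs ≡ ws
  ⇓*-deterministic ev-[] ev-[] = refl
  ⇓*-deterministic (ev-∷ g⇓ gs⇓) (ev-∷ g⇓′ gs⇓′) =
    cong₂ _∷_ (⇓-deterministic g⇓ g⇓′) (⇓*-deterministic gs⇓ gs⇓′)

-- Evaluation with fuel

-- Results of the fuelled evaluator: 0 means "no value within the fuel", suc v means "value v".

guard : ℕ → ℕ → ℕ
guard zero    x = 0
guard (suc _) x = x

guardAll : List ℕ → ℕ → ℕ
guardAll []       x = x
guardAll (y ∷ ys) x = guard y (guardAll ys x)

-- State of an unbounded search after k steps: 0 = still searching, 1 = stuck on a
-- call that ran out of fuel, suc (suc y) = found the least root y.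
searchStep : (state result k : ℕ) → ℕ
searchStep zero zero                k = 1
searchStep zero (suc zero)          k = suc (suc k)
searchStep zero (suc (suc _))       k = 0
searchStep (suc state) result       k = suc state

mutual
  run : Prog → ℕ → List ℕ → ℕ
  run Z        t xs = 1
  run S        t xs = suc (suc (hd xs))
  run (P i)    t xs = suc (nth xs i)
  run (C f gs) t xs = guardAll (runs gs t xs) (run f t (map pred (runs gs t xs)))
  run (R f g)  t xs = runR f g t (hd xs) (tl xs)
  run (M f)    t xs = pred (search f t xs t)

  runs : List Prog → ℕ → List ℕ → List ℕ
  runs []       t xs = []
  runs (g ∷ gs) t xs = run g t xs ∷ runs gs t xs

  runR : Prog → Prog → ℕ → ℕ → List ℕ → ℕ
  runR f g t zero    xs = run f t xs
  runR f g t (suc n) xs = guard (runR f g t n xs) (run g t (n ∷ pred (runR f g t n xs) ∷ xs))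

  search : Prog → ℕ → List ℕ → ℕ → ℕ
  search f t xs zero    = 0
  search f t xs (suc k) = searchStep (search f t xs k) (run f t (k ∷ xs)) k

guardAll-map-suc : ∀ ys x → guardAll (map suc ys) x ≡ x
guardAll-map-suc []       x = refl
guardAll-map-suc (y ∷ ys) x = guardAll-map-suc ys x

map-pred-suc : ∀ ys → map pred (map suc ys) ≡ ys
map-pred-suc ys = trans (sym (map-∘ ys)) (map-id ys)

guard≡suc : ∀ r x v → guard r x ≡ suc v → ∃[ r′ ] r ≡ suc r′ × x ≡ suc v
guard≡suc (suc r) x v eq = r , refl , eq

guardAll≡suc : ∀ ys x v → guardAll ys x ≡ suc v → ∃[ ws ] ys ≡ map suc ws × x ≡ suc v
guardAll≡suc []       x v eq = [] , refl , eq
guardAll≡suc (y ∷ ys) x v eq with guard≡suc y (guardAll ys x) v eq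
... | r , refl , eq′ with guardAll≡suc ys x v eq′
...   | ws , refl , x≡ = r ∷ ws , refl , x≡

NonRootsBelow : (ℕ → ℕ) → ℕ → Set
NonRootsBelow F y = ∀ z → z < y → ∃[ w ] F z ≡ suc (suc w)

search-before : ∀ f t xs k → NonRootsBelow (λ z → run f t (z ∷ xs)) k → search f t xs k ≡ 0
search-before f t xs zero    below = refl
search-before f t xs (suc k) below
  rewrite search-before f t xs k (λ z z<k → below z (m≤n⇒m≤1+n z<k))
  with below k ≤-refl
... | w , eq rewrite eq = refl

search-after : ∀ f t xs y → NonRootsBelow (λ z → run f t (z ∷ xs)) y → run f t (y ∷ xs) ≡ 1 →
               ∀ k → y < k → search f t xs k ≡ suc (suc y)
search-after f t xs y below hit (suc k) (s≤s y≤k) with m≤n⇒m<n∨m≡n y≤k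
... | inj₁ y<k  rewrite search-after f t xs y below hit k y<k = refl
... | inj₂ refl rewrite search-before f t xs y below | hit = refl

search≡0 : ∀ f t xs k → search f t xs k ≡ 0 → NonRootsBelow (λ z → run f t (z ∷ xs)) k
search≡0 f t xs (suc k) eq z z<1+k with search f t xs k in eq-k
search≡0 f t xs (suc k) eq z z<1+k | zero with run f t (k ∷ xs) in eq-run
search≡0 f t xs (suc k) () z z<1+k | zero | zero
search≡0 f t xs (suc k) () z z<1+k | zero | suc zero
search≡0 f t xs (suc k) eq z z<1+k | zero | suc (suc w) with m≤n⇒m<n∨m≡n (s≤s⁻¹ z<1+k)
... | inj₁ z<k  = search≡0 f t xs k eq-k z z<k
... | inj₂ refl = w , eq-run
search≡0 f t xs (suc k) () z z<1+k | suc s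

search≡found : ∀ f t xs k y → search f t xs k ≡ suc (suc y) →
               run f t (y ∷ xs) ≡ 1 × NonRootsBelow (λ z → run f t (z ∷ xs)) y
search≡found f t xs (suc k) y eq with search f t xs k in eq-k
search≡found f t xs (suc k) y eq | zero with run f t (k ∷ xs) in eq-run
search≡found f t xs (suc k) y () | zero | zero
search≡found f t xs (suc k) .k refl | zero | suc zero = eq-run , search≡0 f t xs k eq-k
search≡found f t xs (suc k) y () | zero | suc (suc w)
search≡found f t xs (suc k) y refl | suc (suc s) = search≡found f t xs k y eq-k

mutual
  run-sound : ∀ p t xs v → run p t xs ≡ suc v → p ⊢ xs ⇓ v
  run-sound Z     t xs v refl = ev-Z
  run-sound S     t xs v refl = ev-S
  run-sound (P i) t xs v refl = ev-P
  run-sound (C f gs) t xs v eq with guardAll≡suc (runs gs t xs) _ v eq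
  ... | ws , runs≡ , f≡ = ev-C (runs-sound gs t xs ws runs≡) (run-sound f t ws v
          (trans (cong (run f t) (trans (sym (map-pred-suc ws)) (cong (map pred) (sym runs≡)))) f≡))
  run-sound (R f g) t []       v eq = ev-R[] (ev-R0 (run-sound f t [] v eq))
  run-sound (R f g) t (n ∷ xs) v eq = runR-sound f g t n xs v eq
  run-sound (M f) t xs v eq with search f t xs t in eq-search
  run-sound (M f) t xs v refl | suc (suc y) with search≡found f t xs t y eq-search
  ... | hit , below = ev-M (run-sound f t (y ∷ xs) 0 hit)
                           (λ z z<y → let w , eq-z = below z z<y in w , run-sound f t (z ∷ xs) (suc w) eq-z)

  runR-sound : ∀ f g t n xs v → runR f g t n xs ≡ suc v → R f g ⊢ n ∷ xs ⇓ v
  runR-sound f g t zero    xs v eq = ev-R0 (run-sound f t xs v eq)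
  runR-sound f g t (suc n) xs v eq with guard≡suc (runR f g t n xs) _ v eq
  ... | r , r≡ , g≡ = ev-RS (runR-sound f g t n xs r r≡)
          (run-sound g t (n ∷ r ∷ xs) v (trans (cong (λ q → run g t (n ∷ pred q ∷ xs)) (sym r≡)) g≡))

  runs-sound : ∀ gs t xs ws → runs gs t xs ≡ map suc ws → gs ⊢* xs ⇓ ws
  runs-sound []       t xs []       eq = ev-[]
  runs-sound (g ∷ gs) t xs (w ∷ ws) eq =
    ev-∷ (run-sound g t xs w (proj₁ (∷-injective eq))) (runs-sound gs t xs ws (proj₂ (∷-injective eq)))

Eventually : (ℕ → Set) → Set
Eventually Q = ∃[ T ] (∀ t → T ≤ t → Q t)

eventually-both : ∀ {Q Q′} → Eventually Q → Eventually Q′ → Eventually (λ t → Q t × Q′ t)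
eventually-both (T , q) (T′ , q′) =
  T ⊔ T′ , λ t T⊔T′≤t → q t (≤-trans (m≤m⊔n T T′) T⊔T′≤t) , q′ t (≤-trans (m≤n⊔m T T′) T⊔T′≤t)

eventually-map : ∀ {Q Q′} → (∀ {t} → Q t → Q′ t) → Eventually Q → Eventually Q′
eventually-map q⇒q′ (T , q) = T , λ t T≤t → q⇒q′ (q t T≤t)

eventually-after : ∀ {Q} T → Eventually Q → Eventually (λ t → T ≤ t × Q t)
eventually-after T ev = eventually-both (T , λ _ T≤t → T≤t) ev

eventually-below : ∀ (F : ℕ → ℕ → ℕ) y →
  (∀ z → z < y → ∃[ w ] Eventually (λ t → F t z ≡ suc (suc w))) →
  Eventually (λ t → NonRootsBelow (F t) y)
eventually-below F zero    below = 0 , λ _ _ z ()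
eventually-below F (suc y) below =
  eventually-map extend (eventually-both (eventually-below F y (λ z z<y → below z (m≤n⇒m≤1+n z<y)))
                                         (proj₂ (below y ≤-refl)))
  where
  extend : ∀ {t} → NonRootsBelow (F t) y × F t y ≡ suc (suc (proj₁ (below y ≤-refl))) → NonRootsBelow (F t) (suc y)
  extend (below-y , at-y) z z<1+y with m≤n⇒m<n∨m≡n (s≤s⁻¹ z<1+y)
  ... | inj₁ z<y  = below-y z z<y
  ... | inj₂ refl = _ , at-y

mutual
  run-complete : ∀ {p xs v} → p ⊢ xs ⇓ v → Eventually (λ t → run p t xs ≡ suc v)
  run-complete ev-Z = 0 , λ _ _ → refl
  run-complete ev-S = 0 , λ _ _ → refl
  run-complete ev-P = 0 , λ _ _ → refl
  run-complete (ev-C {f = f} {gs} {xs} {ys} {v} gs⇓ f⇓) =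
    eventually-map composed (eventually-both (runs-complete gs⇓) (run-complete f⇓))
    where
    composed : ∀ {t} → runs gs t xs ≡ map suc ys × run f t ys ≡ suc v → run (C f gs) t xs ≡ suc v
    composed {t} (runs≡ , f≡) = begin
      guardAll (runs gs t xs) (run f t (map pred (runs gs t xs))) ≡⟨ cong (λ zs → guardAll zs (run f t (map pred zs))) runs≡ ⟩
      guardAll (map suc ys) (run f t (map pred (map suc ys)))     ≡⟨ guardAll-map-suc ys _ ⟩
      run f t (map pred (map suc ys))                              ≡⟨ cong (run f t) (map-pred-suc ys) ⟩
      run f t ys                                                   ≡⟨ f≡ ⟩
      suc v                                                        ∎
      where open ≡-Reasoning
  run-complete (ev-R0 f⇓) = run-complete f⇓
  run-complete (ev-RS {f = f} {g} {n} {xs} {r} {v} r⇓ g⇓) =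
    eventually-map step (eventually-both (run-complete r⇓) (run-complete g⇓))
    where
    step : ∀ {t} → runR f g t n xs ≡ suc r × run g t (n ∷ r ∷ xs) ≡ suc v → runR f g t (suc n) xs ≡ suc v
    step {t} (r≡ , g≡) rewrite r≡ = g≡
  run-complete (ev-R[] r⇓) = run-complete r⇓
  run-complete (ev-M {f = f} {xs} {y} hit below) =
    eventually-map found (eventually-after (suc y) (eventually-both (run-complete hit) (search-complete below)))
    where
    found : ∀ {t} → suc y ≤ t × run f t (y ∷ xs) ≡ 1 × NonRootsBelow (λ z → run f t (z ∷ xs)) y →
            run (M f) t xs ≡ suc y
    found {t} (y<t , hit-t , below-t) = cong pred (search-after f t xs y below-t hit-t t y<t)

  search-complete : ∀ {f xs y} → (∀ z → z < y → ∃[ w ] f ⊢ z ∷ xs ⇓ suc w) →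
                    Eventually (λ t → NonRootsBelow (λ z → run f t (z ∷ xs)) y)
  search-complete {f} {xs} {y} below = eventually-below (λ t z → run f t (z ∷ xs)) y
    (λ z z<y → proj₁ (below z z<y) , run-complete (proj₂ (below z z<y)))

  runs-complete : ∀ {gs xs ys} → gs ⊢* xs ⇓ ys → Eventually (λ t → runs gs t xs ≡ map suc ys)
  runs-complete ev-[] = 0 , λ _ _ → refl
  runs-complete (ev-∷ g⇓ gs⇓) =
    eventually-map (λ (g≡ , gs≡) → cong₂ _∷_ g≡ gs≡) (eventually-both (run-complete g⇓) (runs-complete gs⇓))

ONE : Prog
ONE = C S (Z ∷ [])

ONE-⇓ : ∀ {xs} → ONE ⊢ xs ⇓ 1
ONE-⇓ = ev-C (ev-∷ ev-Z ev-[]) ev-S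

PRED : Prog
PRED = R Z (P 0)

PRED-⇓ : ∀ x → PRED ⊢ x ∷ [] ⇓ pred x
PRED-⇓ zero    = ev-R0 ev-Z
PRED-⇓ (suc x) = ev-RS (PRED-⇓ x) ev-P

GUARD : Prog
GUARD = R Z (P 2)

GUARD-⇓ : ∀ r x → GUARD ⊢ r ∷ x ∷ [] ⇓ guard r x
GUARD-⇓ zero    x = ev-R0 ev-Z
GUARD-⇓ (suc r) x = ev-RS (GUARD-⇓ r x) ev-P

GUARD-ALL : List Prog → Prog → Prog
GUARD-ALL []       x = x
GUARD-ALL (h ∷ hs) x = C GUARD (h ∷ GUARD-ALL hs x ∷ [])

GUARD-ALL-⇓ : ∀ {hs zs ys x v} → hs ⊢* zs ⇓ ys → x ⊢ zs ⇓ v → GUARD-ALL hs x ⊢ zs ⇓ guardAll ys v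
GUARD-ALL-⇓ ev-[] x⇓ = x⇓
GUARD-ALL-⇓ {ys = y ∷ ys} {v = v} (ev-∷ h⇓ hs⇓) x⇓ =
  ev-C (ev-∷ h⇓ (ev-∷ (GUARD-ALL-⇓ hs⇓ x⇓) ev-[])) (GUARD-⇓ y (guardAll ys v))

PROJS : ℕ → ℕ → List Prog
PROJS i zero    = []
PROJS i (suc n) = P i ∷ PROJS (suc i) n

nth-length : ∀ zs w ws → nth (zs ++ w ∷ ws) (length zs) ≡ w
nth-length []       w ws = refl
nth-length (z ∷ zs) w ws = nth-length zs w ws

PROJS-⇓ : ∀ zs ws {L} → length ws ≡ L → PROJS (length zs) L ⊢* zs ++ ws ⇓ ws
PROJS-⇓ zs []       refl = ev-[]
PROJS-⇓ zs (w ∷ ws) refl =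
  ev-∷ (subst (P (length zs) ⊢ zs ++ w ∷ ws ⇓_) (nth-length zs w ws) ev-P)
       (subst₂ (λ i l → PROJS i (length ws) ⊢* l ⇓ ws)
               (trans (length-++ zs) (+-comm (length zs) 1))
               (++-assoc zs (w ∷ []) ws)
               (PROJS-⇓ (zs ++ w ∷ []) ws refl))

ADD : Prog
ADD = R (P 0) (C S (P 1 ∷ []))

ADD-⇓ : ∀ a b → ADD ⊢ a ∷ b ∷ [] ⇓ (a + b)
ADD-⇓ zero    b = ev-R0 ev-P
ADD-⇓ (suc a) b = ev-RS (ADD-⇓ a b) (ev-C (ev-∷ ev-P ev-[]) ev-S)

infixl 30 _+ᴾ_ _∸ᴾ_
infixl 31 _*ᴾ_
infix 29 _=ᴾ_

_+ᴾ_ : Prog → Prog → Prog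
p +ᴾ q = C ADD (p ∷ q ∷ [])

+ᴾ-⇓ : ∀ {p q zs a b} → p ⊢ zs ⇓ a → q ⊢ zs ⇓ b → p +ᴾ q ⊢ zs ⇓ (a + b)
+ᴾ-⇓ {a = a} {b = b} p⇓ q⇓ = ev-C (ev-∷ p⇓ (ev-∷ q⇓ ev-[])) (ADD-⇓ a b)

MUL : Prog
MUL = R Z (P 2 +ᴾ P 1)

MUL-⇓ : ∀ a b → MUL ⊢ a ∷ b ∷ [] ⇓ (a * b)
MUL-⇓ zero    b = ev-R0 ev-Z
MUL-⇓ (suc a) b = ev-RS (MUL-⇓ a b) (+ᴾ-⇓ ev-P ev-P)

_*ᴾ_ : Prog → Prog → Prog
p *ᴾ q = C MUL (p ∷ q ∷ [])

*ᴾ-⇓ : ∀ {p q zs a b} → p ⊢ zs ⇓ a → q ⊢ zs ⇓ b → p *ᴾ q ⊢ zs ⇓ (a * b)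
*ᴾ-⇓ {a = a} {b = b} p⇓ q⇓ = ev-C (ev-∷ p⇓ (ev-∷ q⇓ ev-[])) (MUL-⇓ a b)

MONUS : Prog
MONUS = R (P 0) (C PRED (P 1 ∷ []))

MONUS-⇓ : ∀ b a → MONUS ⊢ b ∷ a ∷ [] ⇓ (a ∸ b)
MONUS-⇓ zero    a = ev-R0 ev-P
MONUS-⇓ (suc b) a = subst (MONUS ⊢ suc b ∷ a ∷ [] ⇓_) (pred[m∸n]≡m∸[1+n] a b)
  (ev-RS (MONUS-⇓ b a) (ev-C (ev-∷ ev-P ev-[]) (PRED-⇓ (a ∸ b))))

_∸ᴾ_ : Prog → Prog → Prog
p ∸ᴾ q = C MONUS (q ∷ p ∷ [])

∸ᴾ-⇓ : ∀ {p q zs a b} → p ⊢ zs ⇓ a → q ⊢ zs ⇓ b → p ∸ᴾ q ⊢ zs ⇓ (a ∸ b)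
∸ᴾ-⇓ {a = a} {b = b} p⇓ q⇓ = ev-C (ev-∷ q⇓ (ev-∷ p⇓ ev-[])) (MONUS-⇓ b a)

const : ℕ → Prog
const zero    = Z
const (suc n) = C S (const n ∷ [])

const-⇓ : ∀ n {zs} → const n ⊢ zs ⇓ n
const-⇓ zero    = ev-Z
const-⇓ (suc n) = ev-C (ev-∷ (const-⇓ n) ev-[]) ev-S

isZero : ℕ → ℕ
isZero zero    = 1
isZero (suc _) = 0

IS-ZERO : Prog
IS-ZERO = R ONE Z

IS-ZERO-⇓ : ∀ x → IS-ZERO ⊢ x ∷ [] ⇓ isZero x
IS-ZERO-⇓ zero    = ev-R0 ONE-⇓
IS-ZERO-⇓ (suc x) = ev-RS (IS-ZERO-⇓ x) ev-Z

isEq : ℕ → ℕ → ℕ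
isEq a b = isZero ((a ∸ b) + (b ∸ a))

_=ᴾ_ : Prog → Prog → Prog
p =ᴾ q = C IS-ZERO ((p ∸ᴾ q) +ᴾ (q ∸ᴾ p) ∷ [])

=ᴾ-⇓ : ∀ {p q zs a b} → p ⊢ zs ⇓ a → q ⊢ zs ⇓ b → p =ᴾ q ⊢ zs ⇓ isEq a b
=ᴾ-⇓ p⇓ q⇓ = ev-C (ev-∷ (+ᴾ-⇓ (∸ᴾ-⇓ p⇓ q⇓) (∸ᴾ-⇓ q⇓ p⇓)) ev-[]) (IS-ZERO-⇓ _)

isEq≤1 : ∀ a b → isEq a b ≤ 1
isEq≤1 a b with (a ∸ b) + (b ∸ a)
... | zero  = s≤s z≤n
... | suc _ = z≤n

isEq≢0⇒≡ : ∀ a b → isEq a b ≢ 0 → a ≡ b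
isEq≢0⇒≡ a b isEq≢0 with (a ∸ b) + (b ∸ a) in eq
... | zero  = ≤-antisym (m∸n≡0⇒m≤n (m+n≡0⇒m≡0 (a ∸ b) eq)) (m∸n≡0⇒m≤n (m+n≡0⇒n≡0 (a ∸ b) eq))
... | suc _ = ⊥-elim (isEq≢0 refl)

isEq-refl : ∀ a → isEq a a ≡ 1
isEq-refl a rewrite n∸n≡0 a = refl

isEq-≢ : ∀ a b → a ≢ b → isEq a b ≡ 0
isEq-≢ a b a≢b with isEq a b in eq
... | zero  = refl
... | suc _ = ⊥-elim (a≢b (isEq≢0⇒≡ a b (λ eq′ → 1+n≢0 (trans (sym eq) eq′))))

-- The fuelled evaluator is computable

onReturned : ℕ → ℕ → ℕ
onReturned zero    k = suc (suc k)
onReturned (suc _) k = 0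

onResult : ℕ → ℕ → ℕ
onResult zero    k = 1
onResult (suc j) k = onReturned j k

ON-RETURNED : Prog
ON-RETURNED = R (C S (C S (P 0 ∷ []) ∷ [])) Z

ON-RETURNED-⇓ : ∀ j k → ON-RETURNED ⊢ j ∷ k ∷ [] ⇓ onReturned j k
ON-RETURNED-⇓ zero    k = ev-R0 (ev-C (ev-∷ (ev-C (ev-∷ ev-P ev-[]) ev-S) ev-[]) ev-S)
ON-RETURNED-⇓ (suc j) k = ev-RS (ON-RETURNED-⇓ j k) ev-Z

ON-RESULT : Prog
ON-RESULT = R ONE (C ON-RETURNED (P 0 ∷ P 2 ∷ []))

ON-RESULT-⇓ : ∀ v k → ON-RESULT ⊢ v ∷ k ∷ [] ⇓ onResult v k
ON-RESULT-⇓ zero    k = ev-R0 ONE-⇓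
ON-RESULT-⇓ (suc j) k = ev-RS (ON-RESULT-⇓ j k) (ev-C (ev-∷ ev-P (ev-∷ ev-P ev-[])) (ON-RETURNED-⇓ j k))

SEARCH-STEP : Prog
SEARCH-STEP = R ON-RESULT (C S (P 0 ∷ []))

SEARCH-STEP-⇓ : ∀ s v k → SEARCH-STEP ⊢ s ∷ v ∷ k ∷ [] ⇓ searchStep s v k
SEARCH-STEP-⇓ zero zero                k = ev-R0 (ON-RESULT-⇓ 0 k)
SEARCH-STEP-⇓ zero (suc zero)          k = ev-R0 (ON-RESULT-⇓ 1 k)
SEARCH-STEP-⇓ zero (suc (suc v))       k = ev-R0 (ON-RESULT-⇓ (suc (suc v)) k)
SEARCH-STEP-⇓ (suc s) v                k = ev-RS (SEARCH-STEP-⇓ s v k) (ev-C (ev-∷ ev-P ev-[]) ev-S)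

-- RUN p L runs p with fuel t on inputs xs of length L, given t ∷ xs; knowing L lets it
-- pass the inputs on by projections.
mutual
  RUN : Prog → ℕ → Prog
  RUN Z        L = ONE
  RUN S        L = C S (C S (P 1 ∷ []) ∷ [])
  RUN (P i)    L = C S (P (suc i) ∷ [])
  RUN (C f gs) L = GUARD-ALL (RUNS gs L) (C (RUN f (length gs)) (P 0 ∷ PREDS gs L))
  RUN (R f g)  zero    = C (RUN f 0) (P 0 ∷ [])
  RUN (R f g)  (suc L) = C (RUN-R f g L) (P 1 ∷ P 0 ∷ PROJS 2 L)
  RUN (M f)    L = C PRED (C (SEARCH f L) (P 0 ∷ P 0 ∷ PROJS 1 L) ∷ [])

  RUN-R : Prog → Prog → ℕ → Prog
  RUN-R f g L =
    R (RUN f L) (C GUARD (P 1 ∷ C (RUN g (suc (suc L))) (P 2 ∷ P 0 ∷ C PRED (P 1 ∷ []) ∷ PROJS 3 L) ∷ []))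

  SEARCH : Prog → ℕ → Prog
  SEARCH f L = R Z (C SEARCH-STEP (P 1 ∷ C (RUN f (suc L)) (P 2 ∷ P 0 ∷ PROJS 3 L) ∷ P 0 ∷ []))

  RUNS : List Prog → ℕ → List Prog
  RUNS []       L = []
  RUNS (g ∷ gs) L = RUN g L ∷ RUNS gs L

  PREDS : List Prog → ℕ → List Prog
  PREDS []       L = []
  PREDS (g ∷ gs) L = C PRED (RUN g L ∷ []) ∷ PREDS gs L

length-map-pred-runs : ∀ gs t xs → length (map pred (runs gs t xs)) ≡ length gs
length-map-pred-runs []       t xs = refl
length-map-pred-runs (g ∷ gs) t xs = cong suc (length-map-pred-runs gs t xs)

nth-0 : ∀ xs → nth xs 0 ≡ hd xs
nth-0 []      = refl
nth-0 (x ∷ _) = refl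

mutual
  RUN-⇓ : ∀ p {L} t xs → length xs ≡ L → RUN p L ⊢ t ∷ xs ⇓ run p t xs
  RUN-⇓ Z        t xs _ = ONE-⇓
  RUN-⇓ S        t xs _ =
    ev-C (ev-∷ (ev-C (ev-∷ (subst (P 1 ⊢ t ∷ xs ⇓_) (nth-0 xs) ev-P) ev-[]) ev-S) ev-[]) ev-S
  RUN-⇓ (P i)    t xs _ = ev-C (ev-∷ ev-P ev-[]) ev-S
  RUN-⇓ (C f gs) t xs ∣xs∣ =
    GUARD-ALL-⇓ (RUNS-⇓ gs t xs ∣xs∣)
      (ev-C (ev-∷ ev-P (PREDS-⇓ gs t xs ∣xs∣))
            (RUN-⇓ f t (map pred (runs gs t xs)) (length-map-pred-runs gs t xs)))
  RUN-⇓ (R f g) {zero}  t []       _    = ev-C (ev-∷ ev-P ev-[]) (RUN-⇓ f t [] refl)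
  RUN-⇓ (R f g) {suc L} t (n ∷ xs) ∣xs∣ =
    ev-C (ev-∷ ev-P (ev-∷ ev-P (PROJS-⇓ (t ∷ n ∷ []) xs (suc-injective ∣xs∣))))
         (RUN-R-⇓ f g t n xs (suc-injective ∣xs∣))
  RUN-⇓ (M f)    t xs ∣xs∣ =
    ev-C (ev-∷ (ev-C (ev-∷ ev-P (ev-∷ ev-P (PROJS-⇓ (t ∷ []) xs ∣xs∣))) (SEARCH-⇓ f t xs ∣xs∣ t)) ev-[])
         (PRED-⇓ _)

  RUN-R-⇓ : ∀ f g {L} t n xs → length xs ≡ L → RUN-R f g L ⊢ n ∷ t ∷ xs ⇓ runR f g t n xs
  RUN-R-⇓ f g t zero    xs ∣xs∣ = ev-R0 (RUN-⇓ f t xs ∣xs∣)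
  RUN-R-⇓ f g t (suc n) xs ∣xs∣ =
    ev-RS (RUN-R-⇓ f g t n xs ∣xs∣)
      (ev-C (ev-∷ ev-P (ev-∷ (ev-C (ev-∷ ev-P (ev-∷ ev-P (ev-∷ (ev-C (ev-∷ ev-P ev-[]) (PRED-⇓ _))
                                                      (PROJS-⇓ (n ∷ runR f g t n xs ∷ t ∷ []) xs ∣xs∣))))
                                   (RUN-⇓ g t (n ∷ pred (runR f g t n xs) ∷ xs) (cong (λ l → suc (suc l)) ∣xs∣)))
                             ev-[]))
            (GUARD-⇓ _ _))

  SEARCH-⇓ : ∀ f {L} t xs → length xs ≡ L → ∀ k → SEARCH f L ⊢ k ∷ t ∷ xs ⇓ search f t xs k
  SEARCH-⇓ f t xs ∣xs∣ zero    = ev-R0 ev-Z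
  SEARCH-⇓ f t xs ∣xs∣ (suc k) =
    ev-RS (SEARCH-⇓ f t xs ∣xs∣ k)
      (ev-C (ev-∷ ev-P (ev-∷ (ev-C (ev-∷ ev-P (ev-∷ ev-P (PROJS-⇓ (k ∷ search f t xs k ∷ t ∷ []) xs ∣xs∣)))
                                   (RUN-⇓ f t (k ∷ xs) (cong suc ∣xs∣)))
                             (ev-∷ ev-P ev-[])))
            (SEARCH-STEP-⇓ _ _ _))

  RUNS-⇓ : ∀ gs {L} t xs → length xs ≡ L → RUNS gs L ⊢* t ∷ xs ⇓ runs gs t xs
  RUNS-⇓ []       t xs _    = ev-[]
  RUNS-⇓ (g ∷ gs) t xs ∣xs∣ = ev-∷ (RUN-⇓ g t xs ∣xs∣) (RUNS-⇓ gs t xs ∣xs∣)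

  PREDS-⇓ : ∀ gs {L} t xs → length xs ≡ L → PREDS gs L ⊢* t ∷ xs ⇓ map pred (runs gs t xs)
  PREDS-⇓ []       t xs _    = ev-[]
  PREDS-⇓ (g ∷ gs) t xs ∣xs∣ =
    ev-∷ (ev-C (ev-∷ (RUN-⇓ g t xs ∣xs∣) ev-[]) (PRED-⇓ _)) (PREDS-⇓ gs t xs ∣xs∣)

-- Gödel numbering

triangle : ℕ → ℕ
triangle zero    = 0
triangle (suc s) = suc (s + triangle s)

pair : ℕ → ℕ → ℕ
pair a b = triangle (a + b) + a

pair-suc-zero : ∀ b → pair 0 (suc b) ≡ suc (pair b 0)
pair-suc-zero b = cong suc (begin
  (b + triangle b) + 0 ≡⟨ +-identityʳ _ ⟩
  b + triangle b       ≡⟨ +-comm b _ ⟩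
  triangle b + b       ≡⟨ cong (λ s → triangle s + b) (sym (+-identityʳ b)) ⟩
  triangle (b + 0) + b ∎)
  where open ≡-Reasoning

pair-suc : ∀ a b → pair (suc a) b ≡ suc (pair a (suc b))
pair-suc a b = begin
  suc ((a + b) + triangle (a + b)) + suc a ≡⟨ +-suc _ a ⟩
  suc (suc ((a + b) + triangle (a + b)) + a) ≡⟨ cong (λ s → suc (triangle s + a)) (sym (+-suc a b)) ⟩
  suc (triangle (a + suc b) + a) ∎
  where open ≡-Reasoning

pair≡0 : ∀ a b → pair a b ≡ 0 → a ≡ 0 × b ≡ 0
pair≡0 zero    zero    _  = refl , refl
pair≡0 zero    (suc b) eq = ⊥-elim (1+n≢0 (trans (sym (pair-suc-zero b)) eq))
pair≡0 (suc a) b       eq = ⊥-elim (1+n≢0 (trans (sym (pair-suc a b)) eq))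

unpair-pair : ∀ a b → unpair (pair a b) ≡ (a , b)
unpair-pair a b = go (pair a b) a b refl
  where
  go : ∀ n a b → pair a b ≡ n → unpair n ≡ (a , b)
  go zero    a       b       eq with pair≡0 a b eq
  ... | refl , refl = refl
  go (suc n) (suc a) b       eq rewrite go n a (suc b) (suc-injective (trans (sym (pair-suc a b)) eq)) = refl
  go (suc n) zero    (suc b) eq rewrite go n b 0 (suc-injective (trans (sym (pair-suc-zero b)) eq)) = refl
  go (suc n) zero    zero    ()

fst≤pair : ∀ a b → a ≤ pair a b
fst≤pair a b = m≤n+m a (triangle (a + b))

s≤triangle : ∀ s → s ≤ triangle s
s≤triangle zero    = z≤n
s≤triangle (suc s) = s≤s (m≤m+n s (triangle s))

snd≤pair : ∀ a b → b ≤ pair a b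
snd≤pair a b = begin
  b                      ≤⟨ m≤n+m b a ⟩
  a + b                  ≤⟨ s≤triangle (a + b) ⟩
  triangle (a + b)       ≤⟨ m≤m+n _ a ⟩
  triangle (a + b) + a   ∎
  where open ≤-Reasoning

mutual
  enc : Prog → ℕ
  enc Z        = 0
  enc S        = 1
  enc (P i)    = 2 + i * 6
  enc (C f gs) = 3 + pair (enc f) (encList gs) * 6
  enc (R f g)  = 4 + pair (enc f) (enc g) * 6
  enc (M f)    = 5 + enc f * 6

  encList : List Prog → ℕ
  encList []       = 0
  encList (g ∷ gs) = suc (pair (enc g) (encList gs))

decodeF-tag : ∀ F r q → r < 6 → decodeF (suc F) (r + q * 6) ≡ byTag F r q
decodeF-tag F r q r<6 = cong₂ (byTag F) remainder quotient
  where
  remainder : (r + q * 6) % 6 ≡ r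
  remainder = trans ([m+kn]%n≡m%n r q 6) (m<n⇒m%n≡m r<6)
  quotient : (r + q * 6) / 6 ≡ q
  quotient = begin
    (r + q * 6) / 6     ≡⟨ +-distrib-/ r (q * 6) (subst₂ (λ a b → a + b < 6) (sym (m<n⇒m%n≡m r<6)) (sym (m*n%n≡0 q 6))
                                                        (subst (_< 6) (sym (+-identityʳ r)) r<6)) ⟩
    r / 6 + q * 6 / 6   ≡⟨ cong₂ _+_ (m<n⇒m/n≡0 r<6) (m*n/n≡m q 6) ⟩
    q                   ∎
    where open ≡-Reasoning

payload<code : ∀ r q → q < suc (r + q * 6)
payload<code r q = s≤s (≤-trans (m≤m*n q 6) (m≤n+m (q * 6) r))

mutual
  decodeF-enc : ∀ F p → enc p < F → decodeF F (enc p) ≡ p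
  decodeF-enc (suc F) Z     _ = refl
  decodeF-enc (suc F) S     _ = refl
  decodeF-enc (suc F) (P i) _ = decodeF-tag F 2 i (toWitness {a? = 2 <? 6} tt)
  decodeF-enc (suc F) (C f gs) code<
    rewrite decodeF-tag F 3 (pair (enc f) (encList gs)) (toWitness {a? = 3 <? 6} tt)
          | unpair-pair (enc f) (encList gs)
    = cong₂ C (decodeF-enc F f (below (fst≤pair (enc f) (encList gs))))
              (decodeListF-encList F gs (below (snd≤pair (enc f) (encList gs))))
    where
    below : ∀ {a} → a ≤ pair (enc f) (encList gs) → a < F
    below a≤ = ≤-trans (s≤s a≤) (≤-trans (payload<code 2 _) (s≤s⁻¹ code<))
  decodeF-enc (suc F) (R f g) code<
    rewrite decodeF-tag F 4 (pair (enc f) (enc g)) (toWitness {a? = 4 <? 6} tt)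
          | unpair-pair (enc f) (enc g)
    = cong₂ R (decodeF-enc F f (below (fst≤pair (enc f) (enc g))))
              (decodeF-enc F g (below (snd≤pair (enc f) (enc g))))
    where
    below : ∀ {a} → a ≤ pair (enc f) (enc g) → a < F
    below a≤ = ≤-trans (s≤s a≤) (≤-trans (payload<code 3 _) (s≤s⁻¹ code<))
  decodeF-enc (suc F) (M f) code<
    rewrite decodeF-tag F 5 (enc f) (toWitness {a? = 5 <? 6} tt)
    = cong M (decodeF-enc F f (≤-trans (payload<code 4 _) (s≤s⁻¹ code<)))

  decodeListF-encList : ∀ F gs → encList gs < F → decodeListF F (encList gs) ≡ gs
  decodeListF-encList (suc F) []       _ = refl
  decodeListF-encList (suc F) (g ∷ gs) code< rewrite unpair-pair (enc g) (encList gs) =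
    cong₂ _∷_ (decodeF-enc F g (≤-trans (s≤s (fst≤pair (enc g) (encList gs))) (s≤s⁻¹ code<)))
              (decodeListF-encList F gs (≤-trans (s≤s (snd≤pair (enc g) (encList gs))) (s≤s⁻¹ code<)))

decode-enc : ∀ p → decode (enc p) ≡ p
decode-enc p = decodeF-enc (suc (enc p)) p ≤-refl

-- Kleene's recursion theorem

TRIANGLE : Prog
TRIANGLE = R Z (C S (P 0 +ᴾ P 1 ∷ []))

TRIANGLE-⇓ : ∀ s → TRIANGLE ⊢ s ∷ [] ⇓ triangle s
TRIANGLE-⇓ zero    = ev-R0 ev-Z
TRIANGLE-⇓ (suc s) = ev-RS (TRIANGLE-⇓ s) (ev-C (ev-∷ (+ᴾ-⇓ ev-P ev-P) ev-[]) ev-S)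

PAIR : Prog → Prog → Prog
PAIR p q = C TRIANGLE (p +ᴾ q ∷ []) +ᴾ p

PAIR-⇓ : ∀ {p q zs a b} → p ⊢ zs ⇓ a → q ⊢ zs ⇓ b → PAIR p q ⊢ zs ⇓ pair a b
PAIR-⇓ {a = a} {b = b} p⇓ q⇓ = +ᴾ-⇓ (ev-C (ev-∷ (+ᴾ-⇓ p⇓ q⇓) ev-[]) (TRIANGLE-⇓ (a + b))) p⇓

selfApply : Prog → Prog
selfApply Q = C Q (const (enc Q) ∷ P 0 ∷ P 1 ∷ [])

-- selfApplyCode (enc Q) reduces to enc (selfApply Q).
selfApplyCode : ℕ → ℕ
selfApplyCode x = 3 + pair x (suc (pair (enc (const x)) (encList (P 0 ∷ P 1 ∷ [])))) * 6

ENC-CONST : Prog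
ENC-CONST = R Z (const 3 +ᴾ (PAIR (const 1) (C S (PAIR (P 1) Z ∷ [])) *ᴾ const 6))

ENC-CONST-⇓ : ∀ x → ENC-CONST ⊢ x ∷ [] ⇓ enc (const x)
ENC-CONST-⇓ zero    = ev-R0 ev-Z
ENC-CONST-⇓ (suc x) =
  ev-RS (ENC-CONST-⇓ x) (+ᴾ-⇓ (const-⇓ 3) (*ᴾ-⇓ (PAIR-⇓ (const-⇓ 1) (ev-C (ev-∷ (PAIR-⇓ ev-P ev-Z) ev-[]) ev-S)) (const-⇓ 6)))

SELF-APPLY-CODE : Prog
SELF-APPLY-CODE =
  const 3 +ᴾ (PAIR (P 0) (C S (PAIR (C ENC-CONST (P 0 ∷ [])) (const (encList (P 0 ∷ P 1 ∷ []))) ∷ [])) *ᴾ const 6)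

SELF-APPLY-CODE-⇓ : ∀ x → SELF-APPLY-CODE ⊢ x ∷ [] ⇓ selfApplyCode x
SELF-APPLY-CODE-⇓ x =
  +ᴾ-⇓ (const-⇓ 3)
       (*ᴾ-⇓ (PAIR-⇓ ev-P (ev-C (ev-∷ (PAIR-⇓ (ev-C (ev-∷ ev-P ev-[]) (ENC-CONST-⇓ x))
                                              (const-⇓ (encList (P 0 ∷ P 1 ∷ []))))
                                      ev-[])
                                ev-S))
             (const-⇓ 6))

-- c is the code of selfApply W, where W runs H on (selfApplyCode (enc W), m, n) = (c, m, n).
recursion-theorem : ∀ H → ∃[ c ] (∀ {m n v} → H ⊢ c ∷ m ∷ n ∷ [] ⇓ v → decode c ⊢ m ∷ n ∷ [] ⇓ v)
recursion-theorem H = enc (selfApply W) , λ H⇓ →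
  subst (_⊢ _ ⇓ _) (sym (decode-enc (selfApply W)))
    (ev-C (ev-∷ (const-⇓ (enc W)) (ev-∷ ev-P (ev-∷ ev-P ev-[])))
          (ev-C (ev-∷ (ev-C (ev-∷ ev-P ev-[]) (SELF-APPLY-CODE-⇓ (enc W))) (ev-∷ ev-P (ev-∷ ev-P ev-[]))) H⇓))
  where
  W : Prog
  W = C H (C SELF-APPLY-CODE (P 0 ∷ []) ∷ P 1 ∷ P 2 ∷ [])

no-teaching-set : ∀ G m →
  (∀ Ex → ∃[ m′ ] ¬ (∀ n → G m′ n ≡ G m n) × All (λ e → G m′ (proj₁ e) ≡ G m (proj₁ e)) Ex) →
  ∀ Ex → ¬ IsTeachingSet G m Ex
no-teaching-set G m indistinguishable Ex (labels , separates)
  with m′ , m′≢m , agrees ← indistinguishable Ex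
  with (m′≡m , m≡y) , m′≢y ← All.lookupAny (All.zip (agrees , labels)) (separates m′ m′≢m)
  = m′≢y (trans m′≡m m≡y)

no-teaching-set⇒¬TdimFinite : ∀ G m → (∀ Ex → ¬ IsTeachingSet G m Ex) → ¬ TdimFinite G
no-teaching-set⇒¬TdimFinite G m none (k , teachable) =
  let Ex , _ , teaches = teachable m in none Ex teaches

constant⇒TdimFinite : ∀ G → (∀ m m′ n → G m n ≡ G m′ n) → TdimFinite G
constant⇒TdimFinite G constant =
  0 , λ m → [] , z≤n , [] , λ m′ m′≢m → ⊥-elim (m′≢m (constant m′ m))

points-bounded : ∀ {A : Set} (Ex : List (ℕ × A)) → ∃[ N ] All (λ e → proj₁ e < N) Ex
points-bounded [] = 0 , []
points-bounded ((x , _) ∷ Ex) =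
  let N , below = points-bounded Ex
  in suc x ⊔ N , m≤m⊔n (suc x) N ∷ All.map (λ x<N → ≤-trans x<N (m≤n⊔m (suc x) N)) below

-- The diagonal class

module Diagonal (d : Prog) where

  -- Row m of the class coded by c is the indicator of {m ∸ 1} if d returns 1 on c within
  -- fuel m, and zero otherwise.
  row : ℕ → ℕ → ℕ → ℕ
  row c m n = guard (isEq (run d m (c ∷ [])) 2) (isEq m (suc n))

  ROW : Prog
  ROW = C GUARD (C (RUN d 1) (P 1 ∷ P 0 ∷ []) =ᴾ const 2 ∷ P 1 =ᴾ C S (P 2 ∷ []) ∷ [])

  ROW-⇓ : ∀ c m n → ROW ⊢ c ∷ m ∷ n ∷ [] ⇓ row c m n
  ROW-⇓ c m n =
    ev-C (ev-∷ (=ᴾ-⇓ (ev-C (ev-∷ ev-P (ev-∷ ev-P ev-[])) (RUN-⇓ d m (c ∷ []) refl)) (const-⇓ 2))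
         (ev-∷ (=ᴾ-⇓ ev-P (ev-C (ev-∷ ev-P ev-[]) ev-S)) ev-[]))
      (GUARD-⇓ _ _)

  row-code : ∀ c → (∀ {m n v} → ROW ⊢ c ∷ m ∷ n ∷ [] ⇓ v → decode c ⊢ m ∷ n ∷ [] ⇓ v) → BinaryClassCode c
  row-code c computes = record
    { total  = λ m n → row c m n , computes (ROW-⇓ c m n)
    ; binary = λ m n v c⇓ → subst (_≤ 1) (⇓-deterministic (computes (ROW-⇓ c m n)) c⇓) (row≤1 m n)
    }
    where
    row≤1 : ∀ m n → row c m n ≤ 1
    row≤1 m n with isEq (run d m (c ∷ [])) 2
    ... | zero  = z≤n
    ... | suc _ = isEq≤1 m (suc n)

  returns0⇒row≡0 : ∀ c → d ⊢ c ∷ [] ⇓ 0 → ∀ m n → row c m n ≡ 0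
  returns0⇒row≡0 c d⇓0 m n = cong (λ r → guard r (isEq m (suc n))) (isEq-≢ _ 2 run≢2)
    where
    run≢2 : run d m (c ∷ []) ≢ 2
    run≢2 run≡2 = 0≢1+n (⇓-deterministic d⇓0 (run-sound d m (c ∷ []) 1 run≡2))

  row-0 : ∀ c n → row c 0 n ≡ 0
  row-0 c n with isEq (run d 0 (c ∷ [])) 2
  ... | zero  = refl
  ... | suc _ = refl

  -- Take m′ past both the halting time of d and every point of the sample.
  returns1⇒row0-indistinguishable : ∀ c → d ⊢ c ∷ [] ⇓ 1 → ∀ (Ex : List (ℕ × Fin 2)) →
    ∃[ m′ ] ¬ (∀ n → row c m′ n ≡ row c 0 n) × All (λ e → row c m′ (proj₁ e) ≡ row c 0 (proj₁ e)) Ex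
  returns1⇒row0-indistinguishable c d⇓1 Ex
    with T , halted ← run-complete d⇓1
    with N , below ← points-bounded Ex
    = m′ , differs , All.map (λ {e} → agrees {e}) below
    where
    m′ : ℕ
    m′ = suc (T + N)
    row-m′ : ∀ n → row c m′ n ≡ isEq m′ (suc n)
    row-m′ n rewrite halted m′ (m≤n⇒m≤1+n (m≤m+n T N)) = refl
    differs : ¬ (∀ n → row c m′ n ≡ row c 0 n)
    differs same = 1+n≢0 (begin
      1                     ≡⟨ sym (isEq-refl m′) ⟩
      isEq m′ m′            ≡⟨ sym (row-m′ (T + N)) ⟩
      row c m′ (T + N)      ≡⟨ same (T + N) ⟩
      row c 0 (T + N)       ≡⟨ row-0 c (T + N) ⟩
      0                     ∎)
      where open ≡-Reasoning
    agrees : ∀ {e : ℕ × Fin 2} → proj₁ e < N → row c m′ (proj₁ e) ≡ row c 0 (proj₁ e)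
    agrees {x , _} x<N = begin
      row c m′ x           ≡⟨ row-m′ x ⟩
      isEq m′ (suc x)      ≡⟨ isEq-≢ m′ (suc x) (λ eq → <⇒≢ (≤-trans x<N (m≤n+m N T)) (sym (suc-injective eq))) ⟩
      0                    ≡⟨ sym (row-0 c x) ⟩
      row c 0 x            ∎
      where open ≡-Reasoning

  not-decided : ∀ c → (∀ {m n v} → ROW ⊢ c ∷ m ∷ n ∷ [] ⇓ v → decode c ⊢ m ∷ n ∷ [] ⇓ v) →
                ¬ DecidesFiniteTdim d
  not-decided c computes decides with decides c (row-code c computes)
  ... | inj₁ (d⇓1 , finite)   =
    no-teaching-set⇒¬TdimFinite (row c) 0 (no-teaching-set (row c) 0 (returns1⇒row0-indistinguishable c d⇓1)) finite
  ... | inj₂ (d⇓0 , infinite) =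
    infinite (constant⇒TdimFinite (row c) (λ m m′ n → trans (returns0⇒row≡0 c d⇓0 m n) (sym (returns0⇒row≡0 c d⇓0 m′ n))))

corollary3p9 : ¬ (∃[ e ] DecidesFiniteTdim (decode e))
corollary3p9 (e , decides) =
  let open Diagonal (decode e)
      c , computes = recursion-theorem ROW
  in not-decided c computes decides
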